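{- If $G$ is a graph on $n \ge 2$ vertices and $\overline{G}$ is its complement, then $4 \le b_{\rm g}'(G) + b_{\rm g}'(\overline{G}) \le n+2$.
   Context: The burning game on a finite simple graph $G$ (not necessarily connected) is played by two players, Burner and Staller. Each vertex is either burned or unburned, and once burned it stays burned. In round 1 the starting player chooses one unburned vertex and burns it (selection phase only). Each round $t \ge 2$ consists of a spreading phase, in which every unburned vertex with a burned neighbor becomes burned, followed, if unburned vertices remain, by a selection phase in which the player whose turn it is burns one unburned vertex; the two players make the selections alternately. The game ends in the first round in which all vertices are burned (this may happen right after a spreading phase), and its length is the number of that round. Burner wants to minimize the length and Staller to maximize it. $b_{\rm g}'(G)$ is the length under optimal play when Staller makes the first selection. -}

module Defs where

open import Data.Bool using (Bool; true; false; _∧_; _∨_; not; if_then_else_)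
open import Data.Nat using (ℕ; zero; suc; _+_; _⊔_; _⊓_)
open import Data.Fin using (Fin; _≟_)
open import Data.List using (List; []; _∷_; map; filter; foldr; allFin)
open import Data.Bool.ListAction using (all; any)
open import Relation.Nullary using (¬_)
open import Relation.Nullary.Decidable using (⌊_⌋)
open import Relation.Binary.PropositionalEquality using (_≡_; refl; cong) renaming (sym to ≡-sym)
open import Relation.Nullary using (yes; no)
open import Data.Empty using (⊥-elim)

record Graph (n : ℕ) : Set where
  field
    adj    : Fin n → Fin n → Bool
    adj-sym    : ∀ u v → adj u v ≡ adj v u
    adj-irrefl : ∀ v → adj v v ≡ false
open Graph public

compl-adj : ∀ {n} → Graph n → Fin n → Fin n → Bool
compl-adj G u v = not ⌊ u ≟ v ⌋ ∧ not (adj G u v)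

compl-sym : ∀ {n} (G : Graph n) u v → compl-adj G u v ≡ compl-adj G v u
compl-sym G u v with u ≟ v | v ≟ u
... | yes _ | yes _ = refl
... | yes p | no q  = ⊥-elim (q (≡-sym p))
... | no q  | yes p = ⊥-elim (q (≡-sym p))
... | no _  | no _  = cong (λ b → not b) (Graph.adj-sym G u v)

compl-irrefl : ∀ {n} (G : Graph n) v → compl-adj G v v ≡ false
compl-irrefl G v with v ≟ v
... | yes _ = refl
... | no q  = ⊥-elim (q refl)

complement : ∀ {n} → Graph n → Graph n
complement G = record { adj = compl-adj G ; adj-sym = compl-sym G ; adj-irrefl = compl-irrefl G }

BurnSet : ℕ → Set
BurnSet n = Fin n → Bool

allBurned : ∀ {n} → BurnSet n → Bool
allBurned {n} S = all S (allFin n)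

spread : ∀ {n} → Graph n → BurnSet n → BurnSet n
spread {n} G S u = S u ∨ any (λ v → adj G u v ∧ S v) (allFin n)

burn : ∀ {n} → BurnSet n → Fin n → BurnSet n
burn S v u = S u ∨ ⌊ u ≟ v ⌋

unburned : ∀ {n} → BurnSet n → List (Fin n)
unburned {n} S = filter (λ v → not (S v) Data.Bool.≟ true) (allFin n)
  where import Data.Bool

data Player : Set where
  burner staller : Player

other : Player → Player
other burner  = staller
other staller = burner

maxL : List ℕ → ℕ
maxL = foldr _⊔_ 0

minL : List ℕ → ℕ
minL []       = 0
minL (x ∷ xs) = foldr _⊓_ x xs

opt : Player → List ℕ → ℕ
opt burner  = minL
opt staller = maxL

-- cont k p S: number of further rounds under optimal play, given that the
-- current round has just ended with burned set S and player p makes the next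
-- selection.  k is fuel: each round burns at least one new vertex, so
-- fuel n suffices for every reachable state (the fuel-0 case is unreachable).
cont : ∀ {n} → Graph n → ℕ → Player → BurnSet n → ℕ
cont G zero    p S = 0
cont G (suc k) p S =
  if allBurned S then 0
  else (let S' = spread G S in
        if allBurned S' then 1
        else suc (opt p (map (λ v → cont G k (other p) (burn S' v)) (unburned S'))))

gameLength : ∀ {n} → Graph n → Player → ℕ
gameLength {n} G p =
  opt p (map (λ v → suc (cont G n (other p) (burn (λ _ → false) v))) (allFin n))

bg : ∀ {n} → Graph n → ℕ
bg G = gameLength G burner

bg' : ∀ {n} → Graph n → ℕ
bg' G = gameLength G staller

-- Lower bound: for n ≥ 2 the first selection leaves a vertex unburned,
-- so every game lasts at least two rounds.  Upper bound: if G and its complement are both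
-- connected, each round after the first burns two vertices, so each game lasts at most 1 + ⌊n/2⌋
-- rounds.  Otherwise, say, G has a nonempty proper vertex set S with no edges leaving it; in the
-- complement every vertex outside S is adjacent to every vertex in S, so the complement has
-- diameter at most 2 and its game lasts at most 3 rounds.  If moreover G has a vertex of degree
-- at least 2, some round of its game burns two vertices and the game lasts at most n − 1 rounds;
-- if not, every vertex of the complement is adjacent to all but at most one other vertex, its
-- game lasts at most 2 rounds, and the game on G at most n.  Each upper bound on a game length
-- is obtained from a potential on positions that is positive until the end and drops every round.
module Submission where

open import Data.Bool using (Bool; true; false; _∨_; _∧_; not; if_then_else_)
import Data.Bool as Bool
open import Data.Bool.ListAction using (all; any)
open import Data.Bool.Properties using (not-involutive; ∨-zeroʳ)
open import Data.Empty using (⊥-elim)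
open import Data.Fin using (Fin; _≟_)
open import Data.Fin.Properties using (¬∀⟶∃¬; any?)
open import Data.List using (List; []; _∷_; map; foldr; allFin; length)
open import Data.List.Properties using (length-tabulate)
open import Data.List.Membership.Propositional using (_∈_)
open import Data.List.Membership.Propositional.Properties using (∈-allFin)
open import Data.List.Relation.Unary.All as All using (All; []; _∷_)
open import Data.List.Relation.Unary.All.Properties using (map⁺; tabulate⁺; all-filter)
open import Data.List.Relation.Unary.Any using (here; there)
open import Data.Nat using (ℕ; zero; suc; pred; _+_; _⊓_; _≤_; _≤?_; z≤n; s≤s; ⌊_/2⌋; ⌈_/2⌉; >-nonZero)
open import Data.Nat.Properties hiding (_≟_)
open import Data.Product using (Σ-syntax; _×_; _,_)
open import Data.Sum using (_⊎_; inj₁; inj₂)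
open import Function using (_∘_; case_of_)
open import Relation.Binary.PropositionalEquality
open import Relation.Nullary using (¬_; yes; no)
open import Relation.Nullary.Decidable using (Dec; ⌊_⌋; decidable-stable; ¬¬-excluded-middle; _→-dec_; _×-dec_; ¬?)

open import Defs

true≢false : true ≢ false
true≢false ()

not≡true⇒≡false : ∀ {b} → not b ≡ true → b ≡ false
not≡true⇒≡false {false} _ = refl

not≡false⇒≡true : ∀ {b} → not b ≡ false → b ≡ true
not≡false⇒≡true {true} _ = refl

any-≡true : ∀ {A : Set} (f : A → Bool) {v xs} → v ∈ xs → f v ≡ true → any f xs ≡ true
any-≡true f {xs = x ∷ xs} (here refl) fv rewrite fv = refl
any-≡true f {xs = x ∷ xs} (there v∈xs) fv with f x
... | true  = refl
... | false = any-≡true f v∈xs fv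

all-≡true⇒ : ∀ {A : Set} (f : A → Bool) {v xs} → all f xs ≡ true → v ∈ xs → f v ≡ true
all-≡true⇒ f {xs = x ∷ xs} h v∈xs with f x in fx
all-≡true⇒ f {xs = x ∷ xs} h (here refl) | true  = fx
all-≡true⇒ f {xs = x ∷ xs} h (there v∈xs) | true = all-≡true⇒ f h v∈xs

all-≡true⇐ : ∀ {A : Set} (f : A → Bool) xs → (∀ v → f v ≡ true) → all f xs ≡ true
all-≡true⇐ f []       h = refl
all-≡true⇐ f (x ∷ xs) h rewrite h x = all-≡true⇐ f xs h

all-≡false⇒ : ∀ {A : Set} (f : A → Bool) xs → all f xs ≡ false → Σ[ v ∈ A ] f v ≡ false
all-≡false⇒ f (x ∷ xs) h with f x in fx
... | true  = all-≡false⇒ f xs h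
... | false = x , fx

module _ {n : ℕ} where

  _⊆_ : BurnSet n → BurnSet n → Set
  S ⊆ T = ∀ v → S v ≡ true → T v ≡ true

  ⊆-trans : ∀ {S T U} → S ⊆ T → T ⊆ U → S ⊆ U
  ⊆-trans S⊆T T⊆U v = T⊆U v ∘ S⊆T v

  ⊆-unburned : ∀ {S T} {a} → S ⊆ T → T a ≡ false → S a ≡ false
  ⊆-unburned {S} {a = a} S⊆T Ta with S a in Sa
  ... | false = refl
  ... | true  = ⊥-elim (true≢false (trans (sym (S⊆T a Sa)) Ta))

  ⊆-burn : ∀ (S : BurnSet n) w → S ⊆ burn S w
  ⊆-burn S w v Sv rewrite Sv = refl

  burn-selected : ∀ (S : BurnSet n) w → burn S w w ≡ true
  burn-selected S w with w ≟ w
  ... | yes _  = ∨-zeroʳ (S w)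
  ... | no w≢w = ⊥-elim (w≢w refl)

  ⊆-spread : ∀ (G : Graph n) S → S ⊆ spread G S
  ⊆-spread G S v Sv rewrite Sv = refl

  spread-adj : ∀ (G : Graph n) S {a b} → adj G a b ≡ true → S b ≡ true → spread G S a ≡ true
  spread-adj G S {a} {b} ab Sb =
    trans (cong (S a ∨_) (any-≡true (λ v → adj G a v ∧ S v) (∈-allFin b) (cong₂ _∧_ ab Sb)))
          (∨-zeroʳ (S a))

  afterRound : Graph n → BurnSet n → Fin n → BurnSet n
  afterRound G S w = burn (spread G S) w

  ⊆-afterRound : ∀ (G : Graph n) S w → S ⊆ afterRound G S w
  ⊆-afterRound G S w = ⊆-trans (⊆-spread G S) (⊆-burn (spread G S) w)

  allBurned⇒burned : ∀ {S : BurnSet n} v → allBurned S ≡ true → S v ≡ true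
  allBurned⇒burned {S} v done = all-≡true⇒ S done (∈-allFin v)

  allBurned-intro : ∀ {S : BurnSet n} → (∀ v → S v ≡ true) → allBurned S ≡ true
  allBurned-intro {S} = all-≡true⇐ S (allFin n)

  allBurned-≡false⇒ : ∀ {S : BurnSet n} → allBurned S ≡ false → Σ[ v ∈ Fin n ] S v ≡ false
  allBurned-≡false⇒ {S} = all-≡false⇒ S (allFin n)

  #unburnedIn : BurnSet n → List (Fin n) → ℕ
  #unburnedIn S []       = 0
  #unburnedIn S (v ∷ vs) = (if S v then 0 else 1) + #unburnedIn S vs

  #unburned : BurnSet n → ℕ
  #unburned S = #unburnedIn S (allFin n)

  #unburnedIn-anti-head : ∀ {S T} x → S ⊆ T → (if T x then 0 else 1) ≤ (if S x then 0 else 1)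
  #unburnedIn-anti-head {S} {T} x S⊆T with S x in Sx
  ... | true  rewrite S⊆T x Sx = z≤n
  ... | false with T x
  ...   | true  = z≤n
  ...   | false = ≤-refl

  #unburnedIn-anti : ∀ {S T} xs → S ⊆ T → #unburnedIn T xs ≤ #unburnedIn S xs
  #unburnedIn-anti []       S⊆T = z≤n
  #unburnedIn-anti (x ∷ xs) S⊆T = +-mono-≤ (#unburnedIn-anti-head x S⊆T) (#unburnedIn-anti xs S⊆T)

  #unburnedIn-strict : ∀ {S T} {a} xs → a ∈ xs → S ⊆ T → S a ≡ false → T a ≡ true →
                       suc (#unburnedIn T xs) ≤ #unburnedIn S xs
  #unburnedIn-strict (x ∷ xs) (here refl) S⊆T Sa Ta rewrite Sa | Ta = s≤s (#unburnedIn-anti xs S⊆T)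
  #unburnedIn-strict {S} {T} (x ∷ xs) (there a∈xs) S⊆T Sa Ta =
    subst (_≤ #unburnedIn S (x ∷ xs)) (+-suc (if T x then 0 else 1) (#unburnedIn T xs))
      (+-mono-≤ (#unburnedIn-anti-head x S⊆T) (#unburnedIn-strict xs a∈xs S⊆T Sa Ta))

  #unburned-strict : ∀ {S T} a → S ⊆ T → S a ≡ false → T a ≡ true → suc (#unburned T) ≤ #unburned S
  #unburned-strict a = #unburnedIn-strict (allFin n) (∈-allFin a)

  #unburned-strict₂ : ∀ {S T} {a b} → a ≢ b → S ⊆ T → S a ≡ false → S b ≡ false → T a ≡ true → T b ≡ true →
                      2 + #unburned T ≤ #unburned S
  #unburned-strict₂ {S} {T} {a} {b} a≢b S⊆T Sa Sb Ta Tb =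
    ≤-trans (s≤s (#unburned-strict b Sa⊆T Sab Tb)) (#unburned-strict a (⊆-burn S a) Sa (burn-selected S a))
    where
      Sab : burn S a b ≡ false
      Sab with b ≟ a
      ... | yes b≡a = ⊥-elim (a≢b (sym b≡a))
      ... | no _    rewrite Sb = refl
      Sa⊆T : burn S a ⊆ T
      Sa⊆T v Sav with S v in Sv | v ≟ a
      ... | true  | _        = S⊆T v Sv
      ... | false | yes refl = Ta

  1≤#unburned : ∀ S → allBurned S ≡ false → 1 ≤ #unburned S
  1≤#unburned S unfinished with allBurned-≡false⇒ {S} unfinished
  ... | a , Sa = ≤-trans (s≤s z≤n) (#unburned-strict {T = λ _ → true} a (λ _ _ → refl) Sa refl)

  2≤#unburned : ∀ {S} {a b} → a ≢ b → S a ≡ false → S b ≡ false → 2 ≤ #unburned S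
  2≤#unburned a≢b Sa Sb = ≤-trans (s≤s (s≤s z≤n)) (#unburned-strict₂ {T = λ _ → true} a≢b (λ _ _ → refl) Sa Sb refl refl)

  #unburned-afterRound : ∀ (G : Graph n) S {w} → spread G S w ≡ false → suc (#unburned (afterRound G S w)) ≤ #unburned S
  #unburned-afterRound G S {w} S'w =
    #unburned-strict w (⊆-afterRound G S w) (⊆-unburned (⊆-spread G S) S'w) (burn-selected (spread G S) w)

  #unburned-afterRound₂ : ∀ (G : Graph n) S {a w} → S a ≡ false → spread G S a ≡ true → spread G S w ≡ false →
                          2 + #unburned (afterRound G S w) ≤ #unburned S
  #unburned-afterRound₂ G S {a} {w} Sa S'a S'w =
    #unburned-strict₂ a≢w (⊆-afterRound G S w) Sa (⊆-unburned (⊆-spread G S) S'w)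
      (⊆-burn (spread G S) w a S'a) (burn-selected (spread G S) w)
    where
      a≢w : a ≢ w
      a≢w refl = true≢false (trans (sym S'a) S'w)

  firstBurn : Fin n → BurnSet n
  firstBurn = burn (λ _ → false)

  #unburned-firstBurn : ∀ v → suc (#unburned (firstBurn v)) ≤ n
  #unburned-firstBurn v = subst (suc (#unburned (firstBurn v)) ≤_) #unburned-empty
    (#unburned-strict v (⊆-burn _ v) refl (burn-selected _ v))
    where
      #unburnedIn-empty : ∀ xs → #unburnedIn (λ _ → false) xs ≡ length xs
      #unburnedIn-empty []       = refl
      #unburnedIn-empty (x ∷ xs) = cong suc (#unburnedIn-empty xs)
      #unburned-empty : #unburned (λ _ → false) ≡ n
      #unburned-empty = trans (#unburnedIn-empty (allFin n)) (length-tabulate (λ i → i))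

-- Bounding the length of the game

maxL≤ : ∀ {B} ys → All (_≤ B) ys → maxL ys ≤ B
maxL≤ []       []         = z≤n
maxL≤ (y ∷ ys) (y≤ ∷ ys≤) = ⊔-lub y≤ (maxL≤ ys ys≤)

suc-maxL≤ : ∀ {B} ys → 1 ≤ B → All (λ y → suc y ≤ B) ys → suc (maxL ys) ≤ B
suc-maxL≤ []       1≤B []         = 1≤B
suc-maxL≤ (y ∷ ys) 1≤B (y< ∷ ys<) = ⊔-lub y< (suc-maxL≤ ys 1≤B ys<)

≤-maxL-map : ∀ {A : Set} (f : A → ℕ) {v xs} → v ∈ xs → f v ≤ maxL (map f xs)
≤-maxL-map f (here refl)  = m≤m⊔n _ _
≤-maxL-map f (there v∈xs) = ≤-trans (≤-maxL-map f v∈xs) (m≤n⊔m _ _)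

opt≤maxL : ∀ p ys → opt p ys ≤ maxL ys
opt≤maxL staller ys       = ≤-refl
opt≤maxL burner  []       = z≤n
opt≤maxL burner  (y ∷ ys) = ≤-trans (foldr-⊓≤ y ys) (m≤m⊔n y (maxL ys))
  where
    foldr-⊓≤ : ∀ y ys → foldr _⊓_ y ys ≤ y
    foldr-⊓≤ y []       = ≤-refl
    foldr-⊓≤ y (z ∷ zs) = ≤-trans (m⊓n≤n z _) (foldr-⊓≤ y zs)

module _ {n} (G : Graph n) where

  cont-allBurned : ∀ k p S → allBurned S ≡ true → cont G k p S ≡ 0
  cont-allBurned zero    p S done = refl
  cont-allBurned (suc k) p S done rewrite done = refl

  cont-suc≤ : ∀ k p S {B} → (allBurned S ≡ false → 1 ≤ B) →
              (∀ w → spread G S w ≡ false → suc (cont G k (other p) (afterRound G S w)) ≤ B) →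
              cont G (suc k) p S ≤ B
  cont-suc≤ k p S {B} pos step with allBurned S in done
  ... | true  = z≤n
  ... | false with allBurned (spread G S)
  ...   | true  = pos refl
  ...   | false = ≤-trans (s≤s (opt≤maxL p _)) (suc-maxL≤ _ (pos refl) (map⁺ (All.map
                    (λ {w} unb → step w (not≡true⇒≡false unb))
                    (all-filter (λ v → not (spread G S v) Bool.≟ true) (allFin n)))))

  cont-pos : ∀ k p S v → S v ≡ false → 1 ≤ cont G (suc k) p S
  cont-pos k p S v Sv with allBurned S in done
  ... | true  = ⊥-elim (true≢false (trans (sym (allBurned⇒burned v done)) Sv))
  ... | false with allBurned (spread G S)
  ...   | true  = ≤-refl
  ...   | false = s≤s z≤n

  allBurned-spread⇒cont≤1 : ∀ k p S → allBurned (spread G S) ≡ true → cont G k p S ≤ 1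
  allBurned-spread⇒cont≤1 zero    p S done = z≤n
  allBurned-spread⇒cont≤1 (suc k) p S done = cont-suc≤ k p S (λ _ → ≤-refl)
    λ w S'w → ⊥-elim (true≢false (trans (sym (allBurned⇒burned w done)) S'w))

  module _ (Φ : BurnSet n → ℕ)
           (Φ-pos  : ∀ {S v} → S v ≡ true → allBurned S ≡ false → 1 ≤ Φ S)
           (Φ-drop : ∀ {S v} w → S v ≡ true → spread G S w ≡ false → suc (Φ (afterRound G S w)) ≤ Φ S)
           where

    cont≤potential : ∀ k p S v → S v ≡ true → cont G k p S ≤ Φ S
    cont≤potential zero    p S v Sv = z≤n
    cont≤potential (suc k) p S v Sv = cont-suc≤ k p S (Φ-pos Sv) λ w S'w →
      ≤-trans (s≤s (cont≤potential k (other p) _ v (⊆-afterRound G S w v Sv))) (Φ-drop w Sv S'w)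

  bg'≤ : ∀ {D} → (∀ v → cont G n burner (firstBurn v) ≤ D) → bg' G ≤ suc D
  bg'≤ h = maxL≤ _ (map⁺ (tabulate⁺ (s≤s ∘ h)))

2≤bg' : ∀ {m} (G : Graph (suc (suc m))) → 2 ≤ bg' G
2≤bg' {m} G = ≤-trans (s≤s (cont-pos G (suc m) burner (firstBurn zero) (suc zero) refl))
  (≤-maxL-map (λ v → suc (cont G (suc (suc m)) burner (firstBurn v))) (∈-allFin zero))
  where open Data.Fin using (zero; suc)

bg'≤order : ∀ {m} (G : Graph (suc m)) → bg' G ≤ suc m
bg'≤order {m} G = bg'≤ G λ v →
  ≤-trans (cont≤potential G #unburned (λ {S} _ → 1≤#unburned S) (λ {S} _ _ → #unburned-afterRound G S)
                          (suc m) burner (firstBurn v) v (burn-selected _ v))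
          (pred-mono-≤ (#unburned-firstBurn v))

Connected : ∀ {n} → Graph n → Set
Connected {n} G = ∀ (S : BurnSet n) v w → S v ≡ true → S w ≡ false → Σ[ a ∈ Fin n ] S a ≡ false × spread G S a ≡ true

-- In a connected graph every round burns a vertex by spreading as well as the selected one.
bg'-connected : ∀ {n} (G : Graph n) → Connected G → bg' G ≤ suc ⌊ n /2⌋
bg'-connected {n} G connected = bg'≤ G λ v →
  ≤-trans (cont≤potential G (λ S → ⌈ #unburned S /2⌉) pos drop n burner (firstBurn v) v (burn-selected _ v))
          (⌊n/2⌋-mono (#unburned-firstBurn v))
  where
    pos : ∀ {S : BurnSet n} {v} → S v ≡ true → allBurned S ≡ false → 1 ≤ ⌈ #unburned S /2⌉
    pos {S} _ unfinished = ⌈n/2⌉-mono (1≤#unburned S unfinished)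
    drop : ∀ {S : BurnSet n} {v} w → S v ≡ true → spread G S w ≡ false → suc ⌈ #unburned (afterRound G S w) /2⌉ ≤ ⌈ #unburned S /2⌉
    drop {S} {v} w Sv S'w with connected S v w Sv (⊆-unburned (⊆-spread G S) S'w)
    ... | a , Sa , S'a = ⌈n/2⌉-mono (#unburned-afterRound₂ G S Sa S'a S'w)

Diameter≤2 : ∀ {n} → Graph n → Set
Diameter≤2 {n} G = ∀ a b → adj G a b ≡ true ⊎ Σ[ c ∈ Fin n ] adj G a c ≡ true × adj G c b ≡ true

bg'-diameter≤2 : ∀ {n} (G : Graph n) → Diameter≤2 G → bg' G ≤ 3
bg'-diameter≤2 {n} G diam = bg'≤ G λ v → cont≤2 n burner (firstBurn v) v (burn-selected _ v)
  where
    spread-afterRound : ∀ S v w → S v ≡ true → allBurned (spread G (afterRound G S w)) ≡ true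
    spread-afterRound S v w Sv = allBurned-intro λ x → case diam x v of λ where
      (inj₁ xv)             → spread-adj G _ xv (⊆-afterRound G S w v Sv)
      (inj₂ (c , xc , cv)) → spread-adj G _ xc (⊆-burn (spread G S) w c (spread-adj G S cv Sv))
    cont≤2 : ∀ k p S v → S v ≡ true → cont G k p S ≤ 2
    cont≤2 zero    p S v Sv = z≤n
    cont≤2 (suc k) p S v Sv = cont-suc≤ G k p S (λ _ → s≤s z≤n)
      λ w _ → s≤s (allBurned-spread⇒cont≤1 G k (other p) _ (spread-afterRound S v w Sv))

MissesAtMostOne : ∀ {n} → Graph n → Set
MissesAtMostOne {n} G = ∀ (v a b : Fin n) → a ≢ v → b ≢ v → a ≢ b → adj G v a ≡ true ⊎ adj G v b ≡ true

bg'-missesAtMostOne : ∀ {n} (G : Graph n) → MissesAtMostOne G → bg' G ≤ 2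
bg'-missesAtMostOne {n} G misses = bg'≤ G λ v → cont≤1 n burner (firstBurn v) v (burn-selected _ v)
  where
    afterRound-allBurned : ∀ S v w → S v ≡ true → spread G S w ≡ false → allBurned (afterRound G S w) ≡ true
    afterRound-allBurned S v w Sv S'w = allBurned-intro burned
      where
        w≢v : w ≢ v
        w≢v refl = true≢false (trans (sym (⊆-spread G S w Sv)) S'w)
        burned : ∀ a → afterRound G S w a ≡ true
        burned a with a ≟ v
        ... | yes refl = ⊆-afterRound G S w a Sv
        ... | no a≢v   = case a ≟ w of λ where
          (yes a≡w) → subst (λ x → afterRound G S w x ≡ true) (sym a≡w) (burn-selected (spread G S) w)
          (no a≢w)  → case misses v a w a≢v w≢v a≢w of λ where
            (inj₁ va) → ⊆-burn (spread G S) w a (spread-adj G S (trans (adj-sym G a v) va) Sv)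
            (inj₂ vw) → ⊥-elim (true≢false (trans (sym (spread-adj G S (trans (adj-sym G w v) vw) Sv)) S'w))
    cont≤1 : ∀ k p S v → S v ≡ true → cont G k p S ≤ 1
    cont≤1 zero    p S v Sv = z≤n
    cont≤1 (suc k) p S v Sv = cont-suc≤ G k p S (λ _ → ≤-refl) λ w S'w →
      s≤s (≤-reflexive (cont-allBurned G k (other p) _ (afterRound-allBurned S v w Sv S'w)))

atLeastTwo : Bool → Bool → Bool → Bool
atLeastTwo true  true  _ = true
atLeastTwo true  false c = c
atLeastTwo false b     c = b ∧ c

atLeastTwo-∨ : ∀ a b c a′ b′ c′ → atLeastTwo (a ∨ a′) (b ∨ b′) (c ∨ c′) ≡ true → atLeastTwo a′ b′ c′ ≡ false →
               a ≡ true ⊎ b ≡ true ⊎ c ≡ true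
atLeastTwo-∨ true  _     _     _  _  _  _ _ = inj₁ refl
atLeastTwo-∨ false true  _     _  _  _  _ _ = inj₂ (inj₁ refl)
atLeastTwo-∨ false false true  _  _  _  _ _ = inj₂ (inj₂ refl)
atLeastTwo-∨ false false false _  _  _  h h′ = ⊥-elim (true≢false (trans (sym h) h′))

atLeastTwo-≟ : ∀ {n} {x y z : Fin n} → x ≢ y → x ≢ z → y ≢ z → ∀ w →
               atLeastTwo ⌊ x ≟ w ⌋ ⌊ y ≟ w ⌋ ⌊ z ≟ w ⌋ ≡ false
atLeastTwo-≟ {x = x} {y} {z} x≢y x≢z y≢z w with x ≟ w | y ≟ w | z ≟ w
... | yes refl | yes refl | _        = ⊥-elim (x≢y refl)
... | yes refl | no _     | yes refl = ⊥-elim (x≢z refl)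
... | yes _    | no _     | no _     = refl
... | no _     | yes refl | yes refl = ⊥-elim (y≢z refl)
... | no _     | yes _    | no _     = refl
... | no _     | no _     | _        = refl

Cherry : ∀ {n} → Graph n → Set
Cherry {n} G = Σ[ x ∈ Fin n ] Σ[ y ∈ Fin n ] Σ[ z ∈ Fin n ] y ≢ z × adj G x y ≡ true × adj G x z ≡ true

cherry? : ∀ {n} (G : Graph n) → Dec (Cherry G)
cherry? G = any? λ x → any? λ y → any? λ z →
  ¬? (y ≟ z) ×-dec (adj G x y Bool.≟ true) ×-dec (adj G x z Bool.≟ true)

-- The round in which a second vertex of the path y – x – z burns also burns some vertex by
-- spreading, so it burns at least two vertices; Φ books that extra vertex in advance.
module CherryPotential {n} (G : Graph n) {x y z : Fin n}
                       (xy : adj G x y ≡ true) (xz : adj G x z ≡ true) (y≢z : y ≢ z) where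

  x≢y : x ≢ y
  x≢y refl = true≢false (trans (sym xy) (adj-irrefl G x))

  x≢z : x ≢ z
  x≢z refl = true≢false (trans (sym xz) (adj-irrefl G x))

  twoBurned : BurnSet n → Bool
  twoBurned S = atLeastTwo (S x) (S y) (S z)

  Φ : BurnSet n → ℕ
  Φ S = if twoBurned S then #unburned S else pred (#unburned S)

  pred≤Φ : ∀ S → pred (#unburned S) ≤ Φ S
  pred≤Φ S with twoBurned S
  ... | true  = pred[n]≤n
  ... | false = ≤-refl

  twoBurned≡false⇒2≤#unburned : ∀ S → twoBurned S ≡ false → 2 ≤ #unburned S
  twoBurned≡false⇒2≤#unburned S h with S x in Sx | S y in Sy | S z in Sz
  twoBurned≡false⇒2≤#unburned S () | true  | true  | _
  twoBurned≡false⇒2≤#unburned S () | true  | false | true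
  twoBurned≡false⇒2≤#unburned S _  | true  | false | false = 2≤#unburned y≢z Sy Sz
  twoBurned≡false⇒2≤#unburned S () | false | true  | true
  twoBurned≡false⇒2≤#unburned S _  | false | true  | false = 2≤#unburned x≢z Sx Sz
  twoBurned≡false⇒2≤#unburned S _  | false | false | _     = 2≤#unburned x≢y Sx Sy

  spreads-when-two-burn : ∀ S w → twoBurned S ≡ false → twoBurned (afterRound G S w) ≡ true →
                          Σ[ a ∈ Fin n ] S a ≡ false × spread G S a ≡ true
  spreads-when-two-burn S w before after
    with atLeastTwo-∨ (spread G S x) (spread G S y) (spread G S z) ⌊ x ≟ w ⌋ ⌊ y ≟ w ⌋ ⌊ z ≟ w ⌋
                      after (atLeastTwo-≟ x≢y x≢z y≢z w)
       | S x in Sx | S y in Sy | S z in Sz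
  ... | _               | true  | true  | _     with () ← before
  ... | _               | true  | false | true  with () ← before
  ... | _               | true  | false | false = y , Sy , spread-adj G S (trans (adj-sym G y x) xy) Sx
  ... | _               | false | true  | true  with () ← before
  ... | _               | false | true  | false = x , Sx , spread-adj G S xy Sy
  ... | _               | false | false | true  = x , Sx , spread-adj G S xz Sz
  ... | inj₁ S'x        | false | false | false = x , Sx , S'x
  ... | inj₂ (inj₁ S'y) | false | false | false = y , Sy , S'y
  ... | inj₂ (inj₂ S'z) | false | false | false = z , Sz , S'z

  Φ-pos : ∀ {S : BurnSet n} {v} → S v ≡ true → allBurned S ≡ false → 1 ≤ Φ S
  Φ-pos {S} _ unfinished with twoBurned S in two
  ... | true  = 1≤#unburned S unfinished
  ... | false = pred-mono-≤ (twoBurned≡false⇒2≤#unburned S two)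

  Φ-drop : ∀ {S : BurnSet n} {v} w → S v ≡ true → spread G S w ≡ false → suc (Φ (afterRound G S w)) ≤ Φ S
  Φ-drop {S} w _ S'w with twoBurned (afterRound G S w) in two′
  ... | false = begin
    suc (pred (#unburned S″)) ≡⟨ suc-pred (#unburned S″) {{>-nonZero 1≤#unburnedS″}} ⟩
    #unburned S″              ≤⟨ pred-mono-≤ (#unburned-afterRound G S S'w) ⟩
    pred (#unburned S)        ≤⟨ pred≤Φ S ⟩
    Φ S                       ∎
    where
      open ≤-Reasoning
      S″ = afterRound G S w
      1≤#unburnedS″ : 1 ≤ #unburned S″
      1≤#unburnedS″ = ≤-trans (s≤s z≤n) (twoBurned≡false⇒2≤#unburned S″ two′)
  ... | true with twoBurned S in two
  ...   | true  = #unburned-afterRound G S S'w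
  ...   | false with spreads-when-two-burn S w two two′
  ...     | a , Sa , S'a = pred-mono-≤ (#unburned-afterRound₂ G S Sa S'a S'w)

  Φ-firstBurn : ∀ v → Φ (firstBurn v) ≡ pred (#unburned (firstBurn v))
  Φ-firstBurn v rewrite atLeastTwo-≟ x≢y x≢z y≢z v = refl

bg'-cherry : ∀ {m} (G : Graph (suc (suc m))) → Cherry G → bg' G ≤ suc m
bg'-cherry {m} G (x , y , z , y≢z , xy , xz) = bg'≤ G λ v → begin
  cont G (suc (suc m)) burner (firstBurn v)
    ≤⟨ cont≤potential G Φ (λ {S} → Φ-pos {S}) (λ {S} → Φ-drop {S}) (suc (suc m)) burner (firstBurn v) v (burn-selected _ v) ⟩
  Φ (firstBurn v)
    ≡⟨ Φ-firstBurn v ⟩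
  pred (#unburned (firstBurn v))
    ≤⟨ pred-mono-≤ (pred-mono-≤ (#unburned-firstBurn v)) ⟩
  m ∎
  where
    open CherryPotential G xy xz y≢z
    open ≤-Reasoning

-- Complementary graphs

Complementary : ∀ {n} → Graph n → Graph n → Set
Complementary {n} G H = ∀ (a b : Fin n) → a ≢ b → adj H a b ≡ not (adj G a b)

complementary-complement : ∀ {n} (G : Graph n) → Complementary G (complement G)
complementary-complement G a b a≢b with a ≟ b
... | yes a≡b = ⊥-elim (a≢b a≡b)
... | no _    = refl

complement-complementary : ∀ {n} (G : Graph n) → Complementary (complement G) G
complement-complementary G a b a≢b with a ≟ b
... | yes a≡b = ⊥-elim (a≢b a≡b)
... | no _    = sym (not-involutive (adj G a b))

Closed : ∀ {n} → Graph n → BurnSet n → Set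
Closed G S = ∀ a → spread G S a ≡ true → S a ≡ true

Disconnected : ∀ {n} → Graph n → Set
Disconnected {n} G = Σ[ S ∈ BurnSet n ] Σ[ v ∈ Fin n ] Σ[ w ∈ Fin n ] S v ≡ true × S w ≡ false × Closed G S

¬Disconnected⇒Connected : ∀ {n} (G : Graph n) → ¬ Disconnected G → Connected G
¬Disconnected⇒Connected {n} G ¬disconnected S v w Sv Sw
  with ¬∀⟶∃¬ n (λ a → spread G S a ≡ true → S a ≡ true)
               (λ a → (spread G S a Bool.≟ true) →-dec (S a Bool.≟ true))
               (λ closed → ¬disconnected (S , v , w , Sv , Sw , closed))
... | a , notClosedAt = a , boundary notClosedAt
  where
    boundary : ∀ {s s′} → ¬ (s′ ≡ true → s ≡ true) → s ≡ false × s′ ≡ true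
    boundary {true}          ¬closed = ⊥-elim (¬closed (λ _ → refl))
    boundary {false} {true}  ¬closed = refl , refl
    boundary {false} {false} ¬closed = ⊥-elim (¬closed (λ ()))

Disconnected⇒Diameter≤2 : ∀ {n} {G H : Graph n} → Complementary G H → Disconnected G → Diameter≤2 H
Disconnected⇒Diameter≤2 {G = G} {H} complementary (S , v , w , Sv , Sw , closed) = diameter≤2
  where
    across : ∀ {a b} → S a ≡ true → S b ≡ false → adj H a b ≡ true
    across {a} {b} Sa Sb with adj G a b in ab
    ... | true  = ⊥-elim (true≢false (trans (sym (closed b (spread-adj G S (trans (adj-sym G b a) ab) Sa))) Sb))
    ... | false = trans (complementary a b a≢b) (cong not ab)
      where
        a≢b : a ≢ b
        a≢b refl = true≢false (trans (sym Sa) Sb)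
    across′ : ∀ {a b} → S a ≡ true → S b ≡ false → adj H b a ≡ true
    across′ {a} {b} Sa Sb = trans (adj-sym H b a) (across Sa Sb)
    diameter≤2 : Diameter≤2 H
    diameter≤2 a b with S a in Sa | S b in Sb
    ... | true  | false = inj₁ (across Sa Sb)
    ... | false | true  = inj₁ (across′ Sb Sa)
    ... | true  | true  = inj₂ (w , across Sa Sw , across′ Sb Sw)
    ... | false | false = inj₂ (v , across′ Sv Sa , across Sv Sb)

¬Cherry⇒MissesAtMostOne : ∀ {n} {G H : Graph n} → Complementary G H → ¬ Cherry G → MissesAtMostOne H
¬Cherry⇒MissesAtMostOne {G = G} {H} complementary ¬cherry v a b a≢v b≢v a≢b
  with adj H v a in va | adj H v b in vb
... | true  | _     = inj₁ refl
... | false | true  = inj₂ refl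
... | false | false = ⊥-elim (¬cherry (v , a , b , a≢b , inG a≢v va , inG b≢v vb))
  where
    inG : ∀ {c} → c ≢ v → adj H v c ≡ false → adj G v c ≡ true
    inG {c} c≢v vc = not≡false⇒≡true (trans (sym (complementary v c (≢-sym c≢v))) vc)

module _ {m : ℕ} where

  private
    n = suc (suc m)

  sum≤-disconnected : ∀ {G H : Graph n} → Complementary G H → Disconnected G → bg' G + bg' H ≤ n + 2
  sum≤-disconnected {G} {H} complementary disconnected with cherry? G
  ... | yes cherry = ≤-trans
    (+-mono-≤ (bg'-cherry G cherry) (bg'-diameter≤2 H (Disconnected⇒Diameter≤2 {G = G} {H} complementary disconnected)))
    (≤-reflexive (+-suc (suc m) 2))
  ... | no ¬cherry = +-mono-≤ (bg'≤order G)
    (bg'-missesAtMostOne H (¬Cherry⇒MissesAtMostOne {G = G} {H} complementary ¬cherry))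

  sum≤-connected : ∀ {G H : Graph n} → Connected G → Connected H → bg' G + bg' H ≤ n + 2
  sum≤-connected {G} {H} connectedG connectedH = begin
    bg' G + bg' H                   ≤⟨ +-mono-≤ (bg'-connected G connectedG) (bg'-connected H connectedH) ⟩
    suc ⌊ n /2⌋ + suc ⌊ n /2⌋       ≡⟨ +-suc (suc ⌊ n /2⌋) ⌊ n /2⌋ ⟩
    2 + (⌊ n /2⌋ + ⌊ n /2⌋)         ≤⟨ +-monoʳ-≤ 2 (+-monoʳ-≤ ⌊ n /2⌋ (⌊n/2⌋≤⌈n/2⌉ n)) ⟩
    2 + (⌊ n /2⌋ + ⌈ n /2⌉)         ≡⟨ cong (2 +_) (⌊n/2⌋+⌈n/2⌉≡n n) ⟩
    2 + n                           ≡⟨ +-comm 2 n ⟩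
    n + 2                           ∎
    where open ≤-Reasoning

  -- Disconnectedness quantifies over all vertex sets and is not decided here; the goal is decidable,
  -- so a case split on it is still constructive.
  sum≤ : ∀ (G : Graph n) → bg' G + bg' (complement G) ≤ n + 2
  sum≤ G = decidable-stable (_ ≤? _) λ ¬sum≤ → ¬¬-excluded-middle λ where
    (yes disconnectedG) → ¬sum≤ (sum≤-disconnected (complementary-complement G) disconnectedG)
    (no ¬disconnectedG) → ¬¬-excluded-middle λ where
      (yes disconnectedḠ) → ¬sum≤ (subst (_≤ n + 2) (+-comm (bg' (complement G)) (bg' G))
                                     (sum≤-disconnected (complement-complementary G) disconnectedḠ))
      (no ¬disconnectedḠ) → ¬sum≤ (sum≤-connected (¬Disconnected⇒Connected G ¬disconnectedG)
                                                  (¬Disconnected⇒Connected (complement G) ¬disconnectedḠ))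

proposition3p7 : ∀ (n : ℕ) → 2 ≤ n → (G : Graph n) →
    (4 ≤ bg' G + bg' (complement G)) × (bg' G + bg' (complement G) ≤ n + 2)
proposition3p7 (suc (suc m)) (s≤s (s≤s z≤n)) G = +-mono-≤ (2≤bg' G) (2≤bg' (complement G)) , sum≤ G
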